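{- For every strictly positive formula $A$ and every $n<\omega$, the sequent $A\vdash\Diamond_nA$ is not provable in $\mathrm{RC}^\nabla$.
   Context: Strictly positive formulas are built from propositional variables and $\top$ by $\land$ and unary modalities $\Diamond_n,\nabla_n$ ($n<\omega$). $\mathrm{RC}^\nabla$ is the smallest set of sequents $A\vdash B$ containing the following axioms and closed under the following rules and under substitution: (1) $A\vdash A$; $A\vdash\top$; $A\land B\vdash A$; $A\land B\vdash B$; from $A\vdash B$, $B\vdash C$ infer $A\vdash C$; from $A\vdash B$, $A\vdash C$ infer $A\vdash B\land C$; from $A\vdash B$ infer $aA\vdash aB$ for each modality $a$; (2) $aaA\vdash aA$ for each modality $a$; (3) for $m<n$: $\Diamond_nA\vdash\Diamond_mA$, $\Diamond_nA\land\Diamond_mB\vdash\Diamond_n(A\land\Diamond_mB)$, and the same two with $\nabla$ in place of $\Diamond$; (4) $A\vdash\nabla_nA$, $\Diamond_nA\vdash\nabla_nA$; (5) for $m\le n$: $\Diamond_m\nabla_nA\vdash\Diamond_mA$, $\nabla_n\Diamond_mA\vdash\Diamond_mA$. -}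

module Defs where

open import Data.Nat using (ℕ; _<_; _≤_)
open import Relation.Nullary using (¬_)

data Formula : Set where
  var  : ℕ → Formula
  ⊤'   : Formula
  _∧_  : Formula → Formula → Formula
  ◇    : ℕ → Formula → Formula
  ∇    : ℕ → Formula → Formula

infixr 6 _∧_

data Modality : Set where
  dia  : ℕ → Modality
  nab  : ℕ → Modality

apply : Modality → Formula → Formula
apply (dia n) A = ◇ n A
apply (nab n) A = ∇ n A

subst : (ℕ → Formula) → Formula → Formula
subst σ (var p)  = σ p
subst σ ⊤'       = ⊤'
subst σ (A ∧ B)  = subst σ A ∧ subst σ B
subst σ (◇ n A)  = ◇ n (subst σ A)
subst σ (∇ n A)  = ∇ n (subst σ A)

infix 4 _⊢_
data _⊢_ : Formula → Formula → Set where
  refl⊢   : ∀ {A} → A ⊢ A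
  top     : ∀ {A} → A ⊢ ⊤'
  ∧-elˡ   : ∀ {A B} → A ∧ B ⊢ A
  ∧-elʳ   : ∀ {A B} → A ∧ B ⊢ B
  cut     : ∀ {A B C} → A ⊢ B → B ⊢ C → A ⊢ C
  ∧-intro : ∀ {A B C} → A ⊢ B → A ⊢ C → A ⊢ B ∧ C
  mono    : ∀ {A B} (a : Modality) → A ⊢ B → apply a A ⊢ apply a B
  trans4  : ∀ {A} (a : Modality) → apply a (apply a A) ⊢ apply a A
  ◇-mono  : ∀ {m n A} → m < n → ◇ n A ⊢ ◇ m A
  ◇-J     : ∀ {m n A B} → m < n → ◇ n A ∧ ◇ m B ⊢ ◇ n (A ∧ ◇ m B)
  ∇-mono  : ∀ {m n A} → m < n → ∇ n A ⊢ ∇ m A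
  ∇-J     : ∀ {m n A B} → m < n → ∇ n A ∧ ∇ m B ⊢ ∇ n (A ∧ ∇ m B)
  ∇-refl  : ∀ {n A} → A ⊢ ∇ n A
  ◇→∇     : ∀ {n A} → ◇ n A ⊢ ∇ n A
  ◇∇      : ∀ {m n A} → m ≤ n → ◇ m (∇ n A) ⊢ ◇ m A
  ∇◇      : ∀ {m n A} → m ≤ n → ∇ n (◇ m A) ⊢ ◇ m A
  subst⊢  : ∀ {A B} (σ : ℕ → Formula) → A ⊢ B → subst σ A ⊢ subst σ B

module Submission where

-- Formulas are interpreted as finite sequences (α₀, α₁, …) of ordinals below ε₀ that are
-- normal: each α_{j+1} is at most the last exponent in the Cantor normal form of α_j.
-- Conjunction is the least normal sequence above the pointwise maximum, ◇ₙ normalises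
-- (α₀ + 1, …, αₙ + 1, 0, …), and ∇ₙ cuts the sequence off after αₙ. Every rule of RC^∇ is
-- sound when A ⊢ B is read as ⟦B⟧ ≤ ⟦A⟧ pointwise, while ◇ₙ strictly increases entry n;
-- so A ⊢ ◇ₙ A is never derivable. The one delicate axiom is ◇ₙA ∧ ◇ₘB ⊢ ◇ₙ(A ∧ ◇ₘB):
-- there one needs that an entry j ≤ m of ◇ₘ y has last exponent exactly its successor
-- entry, so that normalising a maximum with it stays strictly below ◇ₙ x ∧ ◇ₘ y.

open import Defs hiding (subst)
open import Data.Bool using (if_then_else_)
open import Data.Empty using (⊥-elim)
open import Data.List using (List; []; _∷_; length)
open import Data.Nat using (ℕ; zero; suc; _+_; s≤s) renaming (_≤_ to _≤ℕ_; _<_ to _<ℕ_)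
import Data.Nat.Properties as ℕ
open import Data.Sum using (_⊎_; inj₁; inj₂; [_,_]′)
open import Function using (_∘_; _$_)
open import Relation.Binary.Bundles using (StrictTotalOrder)
open import Relation.Binary.Definitions
  using (Trichotomous; Transitive; Irreflexive; Asymmetric; Tri; Minimum; tri<; tri≈; tri>)
open import Relation.Binary.PropositionalEquality
  using ( _≡_; _≢_; refl; sym; trans; cong; cong₂; subst; subst₂; isEquivalence; resp₂
        ; module ≡-Reasoning)
open import Relation.Nullary using (¬_; Dec; yes; no; does)
import Algebra.Construct.NaturalChoice.Max as NaturalMax
import Relation.Binary.Properties.StrictTotalOrder as StrictTotalOrderProperties
import Relation.Binary.Reasoning.StrictPartialOrder as StrictPartialOrderReasoning

module Ordinal where

  -- ω^ a + b stands for the ordinal ω^a + b; on Cantor normal forms (CNF below) _<_ is the ordinal order.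
  data Ord : Set where
    𝟎     : Ord
    ω^_+_ : Ord → Ord → Ord

  infix 4 _<_
  data _<_ : Ord → Ord → Set where
    𝟎<ω^+ : ∀ {a b} → 𝟎 < ω^ a + b
    ω^-<  : ∀ {a a′ b b′} → a < a′ → ω^ a + b < ω^ a′ + b′
    +-<   : ∀ {a b b′} → b < b′ → ω^ a + b < ω^ a + b′

  <-irrefl : Irreflexive _≡_ _<_
  <-irrefl refl (ω^-< a<a) = <-irrefl refl a<a
  <-irrefl refl (+-< b<b)  = <-irrefl refl b<b

  <-trans : Transitive _<_
  <-trans 𝟎<ω^+      (ω^-< _)   = 𝟎<ω^+
  <-trans 𝟎<ω^+      (+-< _)    = 𝟎<ω^+
  <-trans (ω^-< p)   (ω^-< q)   = ω^-< (<-trans p q)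
  <-trans (ω^-< p)   (+-< _)    = ω^-< p
  <-trans (+-< _)    (ω^-< q)   = ω^-< q
  <-trans (+-< p)    (+-< q)    = +-< (<-trans p q)

  <-asym : Asymmetric _<_
  <-asym a<b b<a = <-irrefl refl (<-trans a<b b<a)

  <⇒tri : ∀ {a b} → a < b → Tri (a < b) (a ≡ b) (b < a)
  <⇒tri a<b = tri< a<b (λ { refl → <-irrefl refl a<b }) (<-asym a<b)

  >⇒tri : ∀ {a b} → b < a → Tri (a < b) (a ≡ b) (b < a)
  >⇒tri b<a = tri> (<-asym b<a) (λ { refl → <-irrefl refl b<a }) b<a

  <-cmp : Trichotomous _≡_ _<_
  <-cmp 𝟎          𝟎            = tri≈ (λ ()) refl (λ ())
  <-cmp 𝟎          (ω^ _ + _)   = <⇒tri 𝟎<ω^+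
  <-cmp (ω^ _ + _) 𝟎            = >⇒tri 𝟎<ω^+
  <-cmp (ω^ a + b) (ω^ a′ + b′) with <-cmp a a′
  ... | tri< a<a′ _ _ = <⇒tri (ω^-< a<a′)
  ... | tri> _ _ a′<a = >⇒tri (ω^-< a′<a)
  ... | tri≈ _ refl _ with <-cmp b b′
  ...   | tri< b<b′ _ _ = <⇒tri (+-< b<b′)
  ...   | tri≈ _ refl _ = tri≈ (<-irrefl refl) refl (<-irrefl refl)
  ...   | tri> _ _ b′<b = >⇒tri (+-< b′<b)

  <-strictTotalOrder : StrictTotalOrder _ _ _
  <-strictTotalOrder = record
    { isStrictTotalOrder = record
      { isStrictPartialOrder = record
        { isEquivalence = isEquivalence
        ; irrefl        = <-irrefl
        ; trans         = <-trans
        ; <-resp-≈      = resp₂ _<_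
        }
      ; compare = <-cmp
      }
    }

  open StrictTotalOrder <-strictTotalOrder public using (_<?_)
  open StrictTotalOrderProperties <-strictTotalOrder public
    using (_≤_; totalOrder)
    renaming (refl to ≤-refl; reflexive to ≤-reflexive; trans to ≤-trans; antisym to ≤-antisym)
  open NaturalMax totalOrder public
    using (_⊔_; x≤x⊔y; x≤y⊔x; ⊔-lub; ⊔-sel; ⊔-identityˡ; ⊔-identityʳ)

  module ≤-Reasoning = StrictPartialOrderReasoning (StrictTotalOrder.strictPartialOrder <-strictTotalOrder)

  <⇒≤ : ∀ {a b} → a < b → a ≤ b
  <⇒≤ = inj₁

  <-≤-trans : ∀ {a b c} → a < b → b ≤ c → a < c
  <-≤-trans a<b (inj₁ b<c) = <-trans a<b b<c
  <-≤-trans a<b (inj₂ refl) = a<b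

  ≤-<-trans : ∀ {a b c} → a ≤ b → b < c → a < c
  ≤-<-trans (inj₁ a<b) b<c = <-trans a<b b<c
  ≤-<-trans (inj₂ refl) b<c = b<c

  <⇒≱ : ∀ {a b} → a < b → ¬ b ≤ a
  <⇒≱ a<b b≤a = <-irrefl refl (<-≤-trans a<b b≤a)

  ≮⇒≥ : ∀ {a b} → ¬ a < b → b ≤ a
  ≮⇒≥ {a} {b} a≮b with <-cmp a b
  ... | tri< a<b _ _ = ⊥-elim (a≮b a<b)
  ... | tri≈ _ refl _ = inj₂ refl
  ... | tri> _ _ b<a = inj₁ b<a

  𝟎≤ : Minimum _≤_ 𝟎
  𝟎≤ 𝟎          = inj₂ refl
  𝟎≤ (ω^ _ + _) = inj₁ 𝟎<ω^+

  ≮𝟎 : ∀ {a} → ¬ a < 𝟎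
  ≮𝟎 ()

  +-≤ : ∀ {a b b′} → b ≤ b′ → ω^ a + b ≤ ω^ a + b′
  +-≤ (inj₁ b<b′) = inj₁ (+-< b<b′)
  +-≤ (inj₂ refl) = inj₂ refl

  leadExp : Ord → Ord
  leadExp 𝟎          = 𝟎
  leadExp (ω^ a + _) = a

  lastExp : Ord → Ord
  lastExp 𝟎                  = 𝟎
  lastExp (ω^ a + 𝟎)         = a
  lastExp (ω^ _ + (ω^ b + c)) = lastExp (ω^ b + c)

  data CNF : Ord → Set where
    𝟎   : CNF 𝟎
    ω^+ : ∀ {a b} → CNF a → CNF b → leadExp b ≤ a → CNF (ω^ a + b)

  lastExp≤leadExp : ∀ {a} → CNF a → lastExp a ≤ leadExp a
  lastExp≤leadExp 𝟎                          = ≤-refl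
  lastExp≤leadExp (ω^+ _ 𝟎 _)                = ≤-refl
  lastExp≤leadExp (ω^+ _ cb@(ω^+ _ _ _) b≤a) = ≤-trans (lastExp≤leadExp cb) b≤a

  lastExp-ω^+ : ∀ {e b} → 𝟎 < b → lastExp (ω^ e + b) ≡ lastExp b
  lastExp-ω^+ 𝟎<ω^+ = refl

  succ : Ord → Ord
  succ 𝟎          = ω^ 𝟎 + 𝟎
  succ (ω^ a + b) = ω^ a + succ b

  <-succ : ∀ a → a < succ a
  <-succ 𝟎          = 𝟎<ω^+
  <-succ (ω^ _ + b) = +-< (<-succ b)

  <⇒succ≤ : ∀ {a b} → a < b → succ a ≤ b
  <⇒succ≤ {b = ω^ 𝟎 + _}         𝟎<ω^+      = +-≤ (𝟎≤ _)
  <⇒succ≤ {b = ω^ (ω^ _ + _) + _} 𝟎<ω^+      = inj₁ (ω^-< 𝟎<ω^+)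
  <⇒succ≤                         (ω^-< a<a′) = inj₁ (ω^-< a<a′)
  <⇒succ≤                         (+-< b<b′)  = +-≤ (<⇒succ≤ b<b′)

  succ-mono-≤ : ∀ {a b} → a ≤ b → succ a ≤ succ b
  succ-mono-≤ {b = b} (inj₁ a<b) = inj₁ (≤-<-trans (<⇒succ≤ a<b) (<-succ b))
  succ-mono-≤         (inj₂ refl) = ≤-refl

  lastExp-succ : ∀ a → lastExp (succ a) ≡ 𝟎
  lastExp-succ 𝟎                  = refl
  lastExp-succ (ω^ _ + 𝟎)         = refl
  lastExp-succ (ω^ _ + (ω^ b + c)) = lastExp-succ (ω^ b + c)

  CNF-succ : ∀ {a} → CNF a → CNF (succ a)
  CNF-succ 𝟎                           = ω^+ 𝟎 𝟎 ≤-refl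
  CNF-succ (ω^+ ca 𝟎 _)                = ω^+ ca (CNF-succ 𝟎) (𝟎≤ _)
  CNF-succ (ω^+ ca cb@(ω^+ _ _ _) b≤a) = ω^+ ca (CNF-succ cb) b≤a

  CNF-⊔ : ∀ {a b} → CNF a → CNF b → CNF (a ⊔ b)
  CNF-⊔ {a} {b} ca cb with ⊔-sel a b
  ... | inj₁ eq = subst CNF (sym eq) ca
  ... | inj₂ eq = subst CNF (sym eq) cb

  if-does : ∀ {Q A : Set} (P : A → Set) {x y : A} (d : Dec Q) →
            (Q → P x) → (¬ Q → P y) → P (if does d then x else y)
  if-does P (yes q)  onYes _    = onYes q
  if-does P (no ¬q)  _    onNo = onNo ¬q

  -- roundUp g a is the least b ≥ a with g ≤ lastExp b (among b in CNF). Since lastExp 𝟎 = 𝟎,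
  -- for g ≠ 𝟎 this is the least nonzero multiple of ω^g above a, never 𝟎 itself.
  roundUp : Ord → Ord → Ord
  roundUp 𝟎            a                   = a
  roundUp g@(ω^ _ + _) 𝟎                   = ω^ g + 𝟎
  roundUp g@(ω^ _ + _) (ω^ e + 𝟎)          = if does (e <? g) then ω^ g + 𝟎 else ω^ e + 𝟎
  roundUp g@(ω^ _ + _) (ω^ e + (ω^ x + y)) =
    if does (e <? g) then ω^ g + 𝟎 else ω^ e + roundUp g (ω^ x + y)

  𝟎<roundUp : ∀ g a → 𝟎 < g → 𝟎 < roundUp g a
  𝟎<roundUp g@(ω^ _ + _) 𝟎                   _ = 𝟎<ω^+
  𝟎<roundUp g@(ω^ _ + _) (ω^ e + 𝟎)          _ =
    if-does (𝟎 <_) (e <? g) (λ _ → 𝟎<ω^+) (λ _ → 𝟎<ω^+)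
  𝟎<roundUp g@(ω^ _ + _) (ω^ e + (ω^ _ + _)) _ =
    if-does (𝟎 <_) (e <? g) (λ _ → 𝟎<ω^+) (λ _ → 𝟎<ω^+)

  roundUp-≥ : ∀ g a → a ≤ roundUp g a
  roundUp-≥ 𝟎            _                   = ≤-refl
  roundUp-≥ g@(ω^ _ + _) 𝟎                   = 𝟎≤ _
  roundUp-≥ g@(ω^ _ + _) (ω^ e + 𝟎)          =
    if-does (ω^ e + 𝟎 ≤_) (e <? g) (inj₁ ∘ ω^-<) (λ _ → ≤-refl)
  roundUp-≥ g@(ω^ _ + _) (ω^ e + (ω^ x + y)) =
    if-does (ω^ e + (ω^ x + y) ≤_) (e <? g) (inj₁ ∘ ω^-<)
      (λ _ → +-≤ (roundUp-≥ g (ω^ x + y)))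

  ≤-lastExp-roundUp : ∀ g a → g ≤ lastExp (roundUp g a)
  ≤-lastExp-roundUp 𝟎            _                   = 𝟎≤ _
  ≤-lastExp-roundUp g@(ω^ _ + _) 𝟎                   = ≤-refl
  ≤-lastExp-roundUp g@(ω^ _ + _) (ω^ e + 𝟎)          =
    if-does (λ c → g ≤ lastExp c) (e <? g) (λ _ → ≤-refl) ≮⇒≥
  ≤-lastExp-roundUp g@(ω^ _ + _) (ω^ e + (ω^ x + y)) =
    if-does (λ c → g ≤ lastExp c) (e <? g) (λ _ → ≤-refl)
      (λ _ → subst (g ≤_) (sym (lastExp-ω^+ (𝟎<roundUp g (ω^ x + y) 𝟎<ω^+)))
                 (≤-lastExp-roundUp g (ω^ x + y)))

  roundUp-exact : ∀ g a → g < lastExp (roundUp g a) → roundUp g a ≡ a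
  roundUp-exact 𝟎            _                   _   = refl
  roundUp-exact g@(ω^ _ + _) 𝟎                   g<g = ⊥-elim (<-irrefl refl g<g)
  roundUp-exact g@(ω^ _ + _) (ω^ e + 𝟎)          =
    if-does (λ c → g < lastExp c → c ≡ ω^ e + 𝟎) (e <? g)
      (λ _ g<g → ⊥-elim (<-irrefl refl g<g)) (λ _ _ → refl)
  roundUp-exact g@(ω^ _ + _) (ω^ e + (ω^ x + y)) =
    if-does (λ c → g < lastExp c → c ≡ ω^ e + (ω^ x + y)) (e <? g)
      (λ _ g<g → ⊥-elim (<-irrefl refl g<g))
      (λ _ g< → cong (ω^ e +_) (roundUp-exact g (ω^ x + y)
                  (subst (g <_) (lastExp-ω^+ (𝟎<roundUp g (ω^ x + y) 𝟎<ω^+)) g<)))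

  ω^≤ : ∀ {g c} → 𝟎 < g → CNF c → g ≤ lastExp c → ω^ g + 𝟎 ≤ c
  ω^≤ 𝟎<g 𝟎 g≤𝟎 = ⊥-elim (<⇒≱ 𝟎<g g≤𝟎)
  ω^≤ _ cc@(ω^+ _ _ _) g≤ with ≤-trans g≤ (lastExp≤leadExp cc)
  ... | inj₁ g<e  = inj₁ (ω^-< g<e)
  ... | inj₂ refl = +-≤ (𝟎≤ _)

  roundUp-least : ∀ g a {c} → CNF c → a ≤ c → g ≤ lastExp c → roundUp g a ≤ c
  roundUp-least 𝟎            _                   _  a≤c _  = a≤c
  roundUp-least g@(ω^ _ + _) 𝟎                   cc _   g≤ = ω^≤ 𝟎<ω^+ cc g≤
  roundUp-least g@(ω^ _ + _) (ω^ e + 𝟎)          {c} cc a≤c g≤ =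
    if-does (_≤ c) (e <? g) (λ _ → ω^≤ 𝟎<ω^+ cc g≤) (λ _ → a≤c)
  roundUp-least g@(ω^ _ + _) (ω^ e + (ω^ x + y)) {c} cc a≤c g≤ =
    if-does (_≤ c) (e <? g) (λ _ → ω^≤ 𝟎<ω^+ cc g≤) (λ _ → keep-leading-term a≤c cc g≤)
    where
    keep-leading-term : ∀ {c} → ω^ e + (ω^ x + y) ≤ c → CNF c → g ≤ lastExp c →
                        ω^ e + roundUp g (ω^ x + y) ≤ c
    keep-leading-term (inj₁ (ω^-< e<e′)) _ _ = inj₁ (ω^-< e<e′)
    keep-leading-term (inj₁ (+-< b<r)) (ω^+ _ cr _) g≤ =
      +-≤ (roundUp-least g (ω^ x + y) cr (inj₁ b<r)
             (subst (g ≤_) (lastExp-ω^+ (<-trans 𝟎<ω^+ b<r)) g≤))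
    keep-leading-term (inj₂ refl) (ω^+ _ cr _) g≤ = +-≤ (roundUp-least g (ω^ x + y) cr ≤-refl g≤)

  leadExp-roundUp≤ : ∀ {e} g b → leadExp b ≤ e → g ≤ e → leadExp (roundUp g b) ≤ e
  leadExp-roundUp≤     𝟎            _                   b≤e _   = b≤e
  leadExp-roundUp≤     g@(ω^ _ + _) 𝟎                   _   g≤e = g≤e
  leadExp-roundUp≤ {e} g@(ω^ _ + _) (ω^ x + 𝟎)          x≤e g≤e =
    if-does (λ c → leadExp c ≤ e) (x <? g) (λ _ → g≤e) (λ _ → x≤e)
  leadExp-roundUp≤ {e} g@(ω^ _ + _) (ω^ x + (ω^ _ + _)) x≤e g≤e =
    if-does (λ c → leadExp c ≤ e) (x <? g) (λ _ → g≤e) (λ _ → x≤e)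

  CNF-roundUp : ∀ {g a} → CNF g → CNF a → CNF (roundUp g a)
  CNF-roundUp     𝟎              ca                           = ca
  CNF-roundUp     cg@(ω^+ _ _ _) 𝟎                            = ω^+ cg 𝟎 (𝟎≤ _)
  CNF-roundUp {g} cg@(ω^+ _ _ _) ca@(ω^+ {e} _ 𝟎 _)           =
    if-does CNF (e <? g) (λ _ → ω^+ cg 𝟎 (𝟎≤ _)) (λ _ → ca)
  CNF-roundUp {g} cg@(ω^+ _ _ _) (ω^+ {e} {b} ce cb@(ω^+ _ _ _) b≤e) =
    if-does CNF (e <? g) (λ _ → ω^+ cg 𝟎 (𝟎≤ _))
      (λ e≮g → ω^+ ce (CNF-roundUp cg cb) (leadExp-roundUp≤ g b b≤e (≮⇒≥ e≮g)))

  roundUp-mono-≤ : ∀ {g g′ a a′} → CNF g′ → CNF a′ → g ≤ g′ → a ≤ a′ →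
                   roundUp g a ≤ roundUp g′ a′
  roundUp-mono-≤ {g} {g′} {a} {a′} cg′ ca′ g≤g′ a≤a′ =
    roundUp-least g a (CNF-roundUp cg′ ca′)
      (≤-trans a≤a′ (roundUp-≥ g′ a′)) (≤-trans g≤g′ (≤-lastExp-roundUp g′ a′))

  roundUp-fixed : ∀ {g a} → CNF a → g ≤ lastExp a → roundUp g a ≡ a
  roundUp-fixed {g} {a} ca g≤ = ≤-antisym (roundUp-least g a ca ≤-refl g≤) (roundUp-≥ g a)

  lastExp-roundUp-succ : ∀ g a → lastExp (roundUp g (succ a)) ≡ g
  lastExp-roundUp-succ g a with ≤-lastExp-roundUp g (succ a)
  ... | inj₂ g≡ = sym g≡
  ... | inj₁ g< = ⊥-elim (≮𝟎 (subst (g <_) lastExp≡𝟎 g<))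
    where
    lastExp≡𝟎 : lastExp (roundUp g (succ a)) ≡ 𝟎
    lastExp≡𝟎 = trans (cong lastExp (roundUp-exact g (succ a) g<)) (lastExp-succ a)

  roundUp<∨≡ : ∀ g a {c} → CNF c → a ≤ c → g < lastExp c → roundUp g a < c ⊎ a ≡ c
  roundUp<∨≡ g a cc a≤c g<c with roundUp-least g a cc a≤c (<⇒≤ g<c)
  ... | inj₁ r<c  = inj₁ r<c
  ... | inj₂ refl = inj₂ (sym (roundUp-exact g a g<c))

module Model where

  open Ordinal

  V : Set
  V = List Ord

  infixl 9 _!_
  _!_ : V → ℕ → Ord
  []       ! _     = 𝟎
  (x ∷ _)  ! zero  = x
  (_ ∷ xs) ! suc j = xs ! j

  infix 4 _≽_
  record _≽_ (x y : V) : Set where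
    constructor pointwise
    field at : ∀ j → y ! j ≤ x ! j
  open _≽_ public

  ≽-refl : ∀ {x} → x ≽ x
  ≽-refl = pointwise λ _ → ≤-refl

  ≽-trans : ∀ {x y z} → x ≽ y → y ≽ z → x ≽ z
  ≽-trans x≽y y≽z = pointwise λ j → ≤-trans (at y≽z j) (at x≽y j)

  record CNFs (x : V) : Set where
    constructor cnfs
    field cnfAt : ∀ j → CNF (x ! j)
  open CNFs public

  record Normal (x : V) : Set where
    field
      cnf      : CNFs x
      ≤lastExp : ∀ j → x ! suc j ≤ lastExp (x ! j)
  open Normal public

  downward-induction : (P : ℕ → Set) (B : ℕ) →
                       (∀ j → B ≤ℕ j → P j) → (∀ j → P (suc j) → P j) → ∀ j → P j
  downward-induction P B above step j = go B j (ℕ.m≤m+n B j)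
    where
    go : ∀ k j → B ≤ℕ k + j → P j
    go zero    j B≤j   = above j B≤j
    go (suc k) j B≤k+j = step j (go k (suc j) (subst (B ≤ℕ_) (sym (ℕ.+-suc k j)) B≤k+j))

  !-≥length : ∀ xs {j} → length xs ≤ℕ j → xs ! j ≡ 𝟎
  !-≥length []       _           = refl
  !-≥length (_ ∷ xs) (s≤s len≤j) = !-≥length xs len≤j

  normalise : V → V
  normalise []       = []
  normalise (x ∷ xs) = roundUp (normalise xs ! 0) x ∷ normalise xs

  normalise-! : ∀ xs j → normalise xs ! j ≡ roundUp (normalise xs ! suc j) (xs ! j)
  normalise-! []       _       = refl
  normalise-! (_ ∷ _)  zero    = refl
  normalise-! (_ ∷ xs) (suc j) = normalise-! xs j

  normalise-!-≥length : ∀ xs {j} → length xs ≤ℕ j → normalise xs ! j ≡ 𝟎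
  normalise-!-≥length []       _         = refl
  normalise-!-≥length (_ ∷ xs) (s≤s len≤j) = normalise-!-≥length xs len≤j

  CNFs-normalise : ∀ {xs} → CNFs xs → CNFs (normalise xs)
  CNFs-normalise {xs} cs = cnfs (go xs (cnfAt cs))
    where
    go : ∀ xs → (∀ j → CNF (xs ! j)) → ∀ j → CNF (normalise xs ! j)
    go []       _  _       = 𝟎
    go (_ ∷ xs) cs zero    = CNF-roundUp (go xs (cs ∘ suc) 0) (cs 0)
    go (_ ∷ xs) cs (suc j) = go xs (cs ∘ suc) j

  Normal-normalise : ∀ {xs} → CNFs xs → Normal (normalise xs)
  Normal-normalise {xs} cs = record
    { cnf      = CNFs-normalise cs
    ; ≤lastExp = λ j → subst (λ a → normalise xs ! suc j ≤ lastExp a) (sym (normalise-! xs j))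
                         (≤-lastExp-roundUp (normalise xs ! suc j) (xs ! j))
    }

  normalise-≽ : ∀ xs → normalise xs ≽ xs
  normalise-≽ xs = pointwise λ j →
    subst (xs ! j ≤_) (sym (normalise-! xs j)) (roundUp-≥ (normalise xs ! suc j) (xs ! j))

  normalise-least : ∀ {w xs} → Normal w → w ≽ xs → w ≽ normalise xs
  normalise-least {w} {xs} nw w≽xs = pointwise $
    downward-induction (λ j → normalise xs ! j ≤ w ! j) (length xs)
      (λ j len≤j → subst (_≤ w ! j) (sym (normalise-!-≥length xs len≤j)) (𝟎≤ _))
      (λ j ih → subst (_≤ w ! j) (sym (normalise-! xs j))
                  (roundUp-least (normalise xs ! suc j) (xs ! j) (cnfAt (cnf nw) j)
                     (at w≽xs j) (≤-trans ih (≤lastExp nw j))))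

  normalise-mono : ∀ {xs ys} → CNFs xs → xs ≽ ys → normalise xs ≽ normalise ys
  normalise-mono {xs} cs xs≽ys =
    normalise-least (Normal-normalise cs) (≽-trans (normalise-≽ xs) xs≽ys)

  normalise-agrees-above : ∀ {x ys} m → Normal x → (∀ j → m <ℕ j → ys ! j ≡ x ! j) →
                           ∀ j → m <ℕ j → normalise ys ! j ≡ x ! j
  normalise-agrees-above {x} {ys} m nx agree =
    downward-induction (λ j → m <ℕ j → normalise ys ! j ≡ x ! j) (length ys)
      (λ j len≤j m<j →
        trans (normalise-!-≥length ys len≤j) (trans (sym (!-≥length ys len≤j)) (agree j m<j)))
      (λ j ih m<j → begin
        normalise ys ! j                          ≡⟨ normalise-! ys j ⟩
        roundUp (normalise ys ! suc j) (ys ! j)   ≡⟨ cong₂ roundUp (ih (ℕ.m<n⇒m<1+n m<j)) (agree j m<j) ⟩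
        roundUp (x ! suc j) (x ! j)               ≡⟨ roundUp-fixed (cnfAt (cnf nx) j) (≤lastExp nx j) ⟩
        x ! j                                     ∎)
    where open ≡-Reasoning

  prefix : ℕ → (ℕ → Ord) → V
  prefix zero    f = f 0 ∷ []
  prefix (suc n) f = f 0 ∷ prefix n (f ∘ suc)

  length-prefix : ∀ n f → length (prefix n f) ≡ suc n
  length-prefix zero    f = refl
  length-prefix (suc n) f = cong suc (length-prefix n (f ∘ suc))

  prefix-≤ : ∀ n f {j} → j ≤ℕ n → prefix n f ! j ≡ f j
  prefix-≤ zero    f {zero}  _         = refl
  prefix-≤ (suc n) f {zero}  _         = refl
  prefix-≤ (suc n) f {suc j} (s≤s j≤n) = prefix-≤ n (f ∘ suc) j≤n

  prefix-> : ∀ n f {j} → n <ℕ j → prefix n f ! j ≡ 𝟎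
  prefix-> n f {j} n<j = !-≥length (prefix n f) (subst (_≤ℕ j) (sym (length-prefix n f)) n<j)

  CNFs-prefix : ∀ n {f} → (∀ j → j ≤ℕ n → CNF (f j)) → CNFs (prefix n f)
  CNFs-prefix n {f} cf = cnfs λ j →
    [ (λ j≤n → subst CNF (sym (prefix-≤ n f j≤n)) (cf j j≤n))
    , (λ n<j → subst CNF (sym (prefix-> n f n<j)) 𝟎)
    ]′ (ℕ.≤-<-connex j n)

  ≽-prefix : ∀ {x} n {f} → (∀ j → j ≤ℕ n → f j ≤ x ! j) → x ≽ prefix n f
  ≽-prefix n {f} f≤x = pointwise λ j →
    [ (λ j≤n → subst (_≤ _) (sym (prefix-≤ n f j≤n)) (f≤x j j≤n))
    , (λ n<j → subst (_≤ _) (sym (prefix-> n f n<j)) (𝟎≤ _))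
    ]′ (ℕ.≤-<-connex j n)

  prefix-≽ : ∀ {m} n {f} g → m ≤ℕ n → (∀ j → j ≤ℕ m → f j ≤ g j) → prefix n g ≽ prefix m f
  prefix-≽ n g m≤n f≤g = ≽-prefix _ λ j j≤m →
    subst (_ ≤_) (sym (prefix-≤ n g (ℕ.≤-trans j≤m m≤n))) (f≤g j j≤m)

  prefix-≽-vanishing : ∀ {x} n f → (∀ j → n <ℕ j → x ! j ≡ 𝟎) → (∀ j → j ≤ℕ n → x ! j ≤ f j) →
                       prefix n f ≽ x
  prefix-≽-vanishing n f x-vanishes x≤f = pointwise λ j →
    [ (λ j≤n → subst (_ ≤_) (sym (prefix-≤ n f j≤n)) (x≤f j j≤n))
    , (λ n<j → subst (_≤ _) (sym (x-vanishes j n<j)) (𝟎≤ _))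
    ]′ (ℕ.≤-<-connex j n)

  infixl 6 _⊔*_
  _⊔*_ : V → V → V
  []       ⊔* ys       = ys
  (x ∷ xs) ⊔* []       = x ∷ xs
  (x ∷ xs) ⊔* (y ∷ ys) = x ⊔ y ∷ xs ⊔* ys

  !-⊔* : ∀ xs ys j → (xs ⊔* ys) ! j ≡ xs ! j ⊔ ys ! j
  !-⊔* []       ys       j       = sym (⊔-identityˡ 𝟎≤ (ys ! j))
  !-⊔* (x ∷ xs) []       j       = sym (⊔-identityʳ 𝟎≤ ((x ∷ xs) ! j))
  !-⊔* (x ∷ xs) (y ∷ ys) zero    = refl
  !-⊔* (x ∷ xs) (y ∷ ys) (suc j) = !-⊔* xs ys j

  ⊔*-≽ˡ : ∀ xs ys → xs ⊔* ys ≽ xs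
  ⊔*-≽ˡ xs ys = pointwise λ j → subst (xs ! j ≤_) (sym (!-⊔* xs ys j)) (x≤x⊔y (xs ! j) (ys ! j))

  ⊔*-≽ʳ : ∀ xs ys → xs ⊔* ys ≽ ys
  ⊔*-≽ʳ xs ys = pointwise λ j → subst (ys ! j ≤_) (sym (!-⊔* xs ys j)) (x≤y⊔x (xs ! j) (ys ! j))

  ⊔*-least : ∀ {w xs ys} → w ≽ xs → w ≽ ys → w ≽ xs ⊔* ys
  ⊔*-least {w} {xs} {ys} w≽xs w≽ys = pointwise λ j →
    subst (_≤ w ! j) (sym (!-⊔* xs ys j)) (⊔-lub (at w≽xs j) (at w≽ys j))

  CNFs-⊔* : ∀ {xs ys} → CNFs xs → CNFs ys → CNFs (xs ⊔* ys)
  CNFs-⊔* {xs} {ys} cxs cys = cnfs λ j →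
    subst CNF (sym (!-⊔* xs ys j)) (CNF-⊔ (cnfAt cxs j) (cnfAt cys j))


  ⊤ᵛ : V
  ⊤ᵛ = []

  infixr 6 _∧ᵛ_
  _∧ᵛ_ : V → V → V
  x ∧ᵛ y = normalise (x ⊔* y)

  ◇ᵛ : ℕ → V → V
  ◇ᵛ n x = normalise (prefix n (succ ∘ (x !_)))

  ∇ᵛ : ℕ → V → V
  ∇ᵛ n x = prefix n (x !_)

  Normal-⊤ᵛ : Normal ⊤ᵛ
  Normal-⊤ᵛ = record { cnf = cnfs λ _ → 𝟎 ; ≤lastExp = λ _ → ≤-refl }

  Normal-∧ᵛ : ∀ {x y} → CNFs x → CNFs y → Normal (x ∧ᵛ y)
  Normal-∧ᵛ cx cy = Normal-normalise (CNFs-⊔* cx cy)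

  CNFs-succ-prefix : ∀ n {x} → CNFs x → CNFs (prefix n (succ ∘ (x !_)))
  CNFs-succ-prefix n cx = CNFs-prefix n λ j _ → CNF-succ (cnfAt cx j)

  Normal-◇ᵛ : ∀ n {x} → CNFs x → Normal (◇ᵛ n x)
  Normal-◇ᵛ n cx = Normal-normalise (CNFs-succ-prefix n cx)

  Normal-∇ᵛ : ∀ n {x} → Normal x → Normal (∇ᵛ n x)
  Normal-∇ᵛ n {x} nx = record
    { cnf      = CNFs-prefix n λ j _ → cnfAt (cnf nx) j
    ; ≤lastExp = λ j → [ (λ j<n → subst₂ (λ a b → a ≤ lastExp b) (sym (prefix-≤ n (x !_) j<n))
                                            (sym (prefix-≤ n (x !_) (ℕ.<⇒≤ j<n))) (≤lastExp nx j))
                       , (λ n≤j → subst (_≤ lastExp (∇ᵛ n x ! j)) (sym (prefix-> n (x !_) (s≤s n≤j)))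
                                        (𝟎≤ _))
                       ]′ (ℕ.<-≤-connex j n)
    }

  CNFs-∇ᵛ : ∀ n {x} → CNFs x → CNFs (∇ᵛ n x)
  CNFs-∇ᵛ n cx = CNFs-prefix n λ j _ → cnfAt cx j

  ∧ᵛ-≽ˡ : ∀ x y → x ∧ᵛ y ≽ x
  ∧ᵛ-≽ˡ x y = ≽-trans (normalise-≽ (x ⊔* y)) (⊔*-≽ˡ x y)

  ∧ᵛ-≽ʳ : ∀ x y → x ∧ᵛ y ≽ y
  ∧ᵛ-≽ʳ x y = ≽-trans (normalise-≽ (x ⊔* y)) (⊔*-≽ʳ x y)

  ∧ᵛ-greatest : ∀ {w x y} → Normal w → w ≽ x → w ≽ y → w ≽ x ∧ᵛ y
  ∧ᵛ-greatest nw w≽x w≽y = normalise-least nw (⊔*-least w≽x w≽y)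

  ∧ᵛ-! : ∀ x y j → (x ∧ᵛ y) ! j ≡ roundUp ((x ∧ᵛ y) ! suc j) (x ! j ⊔ y ! j)
  ∧ᵛ-! x y j = trans (normalise-! (x ⊔* y) j) (cong (roundUp ((x ∧ᵛ y) ! suc j)) (!-⊔* x y j))

  ∧ᵛ-!-above : ∀ {x w} m → Normal x → (∀ j → m <ℕ j → w ! j ≡ 𝟎) →
               ∀ j → m <ℕ j → (x ∧ᵛ w) ! j ≡ x ! j
  ∧ᵛ-!-above {x} {w} m nx w-vanishes = normalise-agrees-above {ys = x ⊔* w} m nx λ j m<j → begin
    (x ⊔* w) ! j   ≡⟨ !-⊔* x w j ⟩
    x ! j ⊔ w ! j  ≡⟨ cong (x ! j ⊔_) (w-vanishes j m<j) ⟩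
    x ! j ⊔ 𝟎      ≡⟨ ⊔-identityʳ 𝟎≤ (x ! j) ⟩
    x ! j          ∎
    where open ≡-Reasoning

  ◇ᵛ-! : ∀ n x {j} → j ≤ℕ n → ◇ᵛ n x ! j ≡ roundUp (◇ᵛ n x ! suc j) (succ (x ! j))
  ◇ᵛ-! n x {j} j≤n = trans (normalise-! (prefix n (succ ∘ (x !_))) j)
                           (cong (roundUp (◇ᵛ n x ! suc j)) (prefix-≤ n (succ ∘ (x !_)) j≤n))

  ◇ᵛ-> : ∀ n x {j} → n <ℕ j → ◇ᵛ n x ! j ≡ 𝟎
  ◇ᵛ-> n x {j} n<j = normalise-!-≥length (prefix n (succ ∘ (x !_)))
                       (subst (_≤ℕ j) (sym (length-prefix n (succ ∘ (x !_)))) n<j)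

  succ≤◇ᵛ : ∀ n x {j} → j ≤ℕ n → succ (x ! j) ≤ ◇ᵛ n x ! j
  succ≤◇ᵛ n x {j} j≤n =
    subst (succ (x ! j) ≤_) (sym (◇ᵛ-! n x j≤n)) (roundUp-≥ (◇ᵛ n x ! suc j) (succ (x ! j)))

  lastExp-◇ᵛ : ∀ n x {j} → j ≤ℕ n → lastExp (◇ᵛ n x ! j) ≡ ◇ᵛ n x ! suc j
  lastExp-◇ᵛ n x {j} j≤n =
    trans (cong lastExp (◇ᵛ-! n x j≤n)) (lastExp-roundUp-succ (◇ᵛ n x ! suc j) (x ! j))

  ◇ᵛ-strict : ∀ n x → x ! n < ◇ᵛ n x ! n
  ◇ᵛ-strict n x = <-≤-trans (<-succ (x ! n)) (succ≤◇ᵛ n x ℕ.≤-refl)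

  ◇ᵛ-mono : ∀ n {x y} → CNFs x → x ≽ y → ◇ᵛ n x ≽ ◇ᵛ n y
  ◇ᵛ-mono n cx x≽y =
    normalise-mono (CNFs-succ-prefix n cx) (prefix-≽ n _ ℕ.≤-refl λ j _ → succ-mono-≤ (at x≽y j))

  ◇ᵛ-anti : ∀ {m n} x → m ≤ℕ n → CNFs x → ◇ᵛ n x ≽ ◇ᵛ m x
  ◇ᵛ-anti {n = n} x m≤n cx = normalise-mono (CNFs-succ-prefix n cx) (prefix-≽ n _ m≤n λ _ _ → ≤-refl)

  ◇ᵛ-idem : ∀ n x → ◇ᵛ n (◇ᵛ n x) ≽ ◇ᵛ n x
  ◇ᵛ-idem n x = ≽-trans (normalise-≽ _) (prefix-≽-vanishing n _ (λ j → ◇ᵛ-> n x) λ j _ → <⇒≤ (<-succ _))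

  ◇ᵛ≽∇ᵛ : ∀ n x → ◇ᵛ n x ≽ ∇ᵛ n x
  ◇ᵛ≽∇ᵛ n x = ≽-trans (normalise-≽ _) (prefix-≽ n _ ℕ.≤-refl λ j _ → <⇒≤ (<-succ (x ! j)))

  ◇ᵛ∇ᵛ : ∀ {m n} x → m ≤ℕ n → CNFs x → ◇ᵛ m (∇ᵛ n x) ≽ ◇ᵛ m x
  ◇ᵛ∇ᵛ {m} {n} x m≤n cx = normalise-mono (CNFs-succ-prefix m (CNFs-∇ᵛ n cx)) $
    prefix-≽ m _ ℕ.≤-refl λ j j≤m →
      ≤-reflexive (cong succ (sym (prefix-≤ n (x !_) (ℕ.≤-trans j≤m m≤n))))

  ∇ᵛ◇ᵛ : ∀ {m n} x → m ≤ℕ n → ∇ᵛ n (◇ᵛ m x) ≽ ◇ᵛ m x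
  ∇ᵛ◇ᵛ {m} {n} x m≤n =
    prefix-≽-vanishing n _ (λ j n<j → ◇ᵛ-> m x (ℕ.≤-<-trans m≤n n<j)) λ _ _ → ≤-refl

  ≽-∇ᵛ : ∀ n x → x ≽ ∇ᵛ n x
  ≽-∇ᵛ n x = ≽-prefix n λ _ _ → ≤-refl

  ∇ᵛ-mono : ∀ n {x y} → x ≽ y → ∇ᵛ n x ≽ ∇ᵛ n y
  ∇ᵛ-mono n x≽y = prefix-≽ n _ ℕ.≤-refl λ j _ → at x≽y j

  ∇ᵛ-idem : ∀ n x → ∇ᵛ n (∇ᵛ n x) ≽ ∇ᵛ n x
  ∇ᵛ-idem n x = prefix-≽ n _ ℕ.≤-refl λ j j≤n → ≤-reflexive (sym (prefix-≤ n (x !_) j≤n))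

  ∇ᵛ-anti : ∀ {m n} x → m ≤ℕ n → ∇ᵛ n x ≽ ∇ᵛ m x
  ∇ᵛ-anti {n = n} x m≤n = prefix-≽ n _ m≤n λ _ _ → ≤-refl

  module _ {m n} (m<n : m <ℕ n) {x y} (nx : Normal x) (cy : CNFs y) where
    private
      u v P Z Q : V
      u = ◇ᵛ n x
      v = ◇ᵛ m y
      P = u ∧ᵛ v
      Z = x ∧ᵛ v
      Q = ◇ᵛ n Z

      nP : Normal P
      nP = Normal-∧ᵛ (cnf (Normal-◇ᵛ n (cnf nx))) (cnf (Normal-◇ᵛ m cy))

      x<P : ∀ {j} → j ≤ℕ n → x ! j < P ! j
      x<P {j} j≤n = <-≤-trans (<-succ (x ! j)) (≤-trans (succ≤◇ᵛ n x j≤n) (at (∧ᵛ-≽ˡ u v) j))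

      join-below-P : ∀ {j} → j <ℕ n → Z ! suc j < P ! suc j → x ! j ⊔ v ! j ≢ P ! j
      join-below-P {j} j<n Z<P c≡P with ⊔-sel (x ! j) (v ! j)
      ... | inj₁ c≡x = <-irrefl (trans (sym c≡x) c≡P) (x<P (ℕ.<⇒≤ j<n))
      ... | inj₂ c≡v with ℕ.≤-<-connex j m
      ...   | inj₂ m<j =
        ≮𝟎 (subst (x ! j <_) (trans (sym c≡P) (trans c≡v (◇ᵛ-> m y m<j))) (x<P (ℕ.<⇒≤ j<n)))
      ...   | inj₁ j≤m = begin-contradiction
              v ! suc j        ≤⟨ at (∧ᵛ-≽ʳ x v) (suc j) ⟩
              Z ! suc j        <⟨ Z<P ⟩
              P ! suc j        ≤⟨ ≤lastExp nP j ⟩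
              lastExp (P ! j)  ≡⟨ cong lastExp (trans (sym c≡P) c≡v) ⟩
              lastExp (v ! j)  ≡⟨ lastExp-◇ᵛ m y j≤m ⟩
              v ! suc j        ∎
        where open ≤-Reasoning

      Z<P : ∀ {j} → j ≤ℕ n → (j <ℕ n → Z ! suc j < P ! suc j) → Z ! j < P ! j
      Z<P {j} j≤n Z<P-above with ℕ.m≤n⇒m<n∨m≡n j≤n
      ... | inj₂ refl = subst (_< P ! j) (sym (∧ᵛ-!-above m nx (λ _ → ◇ᵛ-> m y) j m<n)) (x<P j≤n)
      ... | inj₁ j<n with roundUp<∨≡ (Z ! suc j) (x ! j ⊔ v ! j) (cnfAt (cnf nP) j)
                            (⊔-lub (<⇒≤ (x<P j≤n)) (at (∧ᵛ-≽ʳ u v) j))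
                            (<-≤-trans (Z<P-above j<n) (≤lastExp nP j))
      ...   | inj₁ r<P = subst (_< P ! j) (sym (∧ᵛ-! x v j)) r<P
      ...   | inj₂ c≡P = ⊥-elim (join-below-P j<n (Z<P-above j<n) c≡P)

      Q≤P : ∀ j → Q ! j ≤ P ! j
      Q≤P = downward-induction (λ j → Q ! j ≤ P ! j) (suc n) (λ j → Q-above) step
        where
        Q-above : ∀ {j} → n <ℕ j → Q ! j ≤ P ! j
        Q-above {j} n<j = subst (_≤ P ! j) (sym (◇ᵛ-> n Z n<j)) (𝟎≤ _)
        step : ∀ j → Q ! suc j ≤ P ! suc j → Q ! j ≤ P ! j
        step j ih with ℕ.≤-<-connex j n
        ... | inj₂ n<j = Q-above n<j
        ... | inj₁ j≤n = subst (_≤ P ! j) (sym (◇ᵛ-! n Z j≤n))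
                           (roundUp-least (Q ! suc j) (succ (Z ! j)) (cnfAt (cnf nP) j)
                             (<⇒succ≤ (Z<P j≤n λ j<n →
                               <-≤-trans (<-succ _) (≤-trans (succ≤◇ᵛ n Z j<n) ih)))
                             (≤-trans ih (≤lastExp nP j)))

    ◇ᵛ-J : ◇ᵛ n x ∧ᵛ ◇ᵛ m y ≽ ◇ᵛ n (x ∧ᵛ ◇ᵛ m y)
    ◇ᵛ-J = pointwise Q≤P

  module _ {m n} (m<n : m <ℕ n) {x y} (nx : Normal x) (cy : CNFs y) where
    private
      w L Z : V
      w = ∇ᵛ m y
      L = ∇ᵛ n x ∧ᵛ w
      Z = x ∧ᵛ w

      nL : Normal L
      nL = Normal-∧ᵛ (CNFs-∇ᵛ n (cnf nx)) (CNFs-∇ᵛ m cy)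

      Z≤L : ∀ j → j ≤ℕ n → Z ! j ≤ L ! j
      Z≤L = downward-induction (λ j → j ≤ℕ n → Z ! j ≤ L ! j) (suc n)
              (λ j n<j j≤n → ⊥-elim (ℕ.<⇒≱ n<j j≤n)) step
        where
        step : ∀ j → (suc j ≤ℕ n → Z ! suc j ≤ L ! suc j) → j ≤ℕ n → Z ! j ≤ L ! j
        step j ih j≤n with ℕ.m≤n⇒m<n∨m≡n j≤n
        ... | inj₂ refl = subst₂ _≤_ (sym (∧ᵛ-!-above m nx (λ _ → prefix-> m (y !_)) j m<n)) refl
                            (subst (_≤ L ! j) (prefix-≤ j (x !_) ℕ.≤-refl) (at (∧ᵛ-≽ˡ (∇ᵛ j x) w) j))
        ... | inj₁ j<n = subst₂ _≤_ (sym (∧ᵛ-! x w j)) (sym (∧ᵛ-! (∇ᵛ n x) w j))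
                           (roundUp-mono-≤ (cnfAt (cnf nL) (suc j))
                             (CNF-⊔ (cnfAt (CNFs-∇ᵛ n (cnf nx)) j) (cnfAt (CNFs-∇ᵛ m cy) j))
                             (ih j<n)
                             (≤-reflexive (cong (_⊔ w ! j) (sym (prefix-≤ n (x !_) j≤n)))))

    ∇ᵛ-J : ∇ᵛ n x ∧ᵛ ∇ᵛ m y ≽ ∇ᵛ n (x ∧ᵛ ∇ᵛ m y)
    ∇ᵛ-J = ≽-prefix n Z≤L

open Ordinal
open Model

⟦_⟧ : Formula → (ℕ → V) → V
⟦ var p ⟧ ρ = ρ p
⟦ ⊤'    ⟧ ρ = ⊤ᵛ
⟦ A ∧ B ⟧ ρ = ⟦ A ⟧ ρ ∧ᵛ ⟦ B ⟧ ρ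
⟦ ◇ n A ⟧ ρ = ◇ᵛ n (⟦ A ⟧ ρ)
⟦ ∇ n A ⟧ ρ = ∇ᵛ n (⟦ A ⟧ ρ)

NormalValuation : (ℕ → V) → Set
NormalValuation ρ = ∀ p → Normal (ρ p)

Normal-⟦⟧ : ∀ A {ρ} → NormalValuation ρ → Normal (⟦ A ⟧ ρ)
Normal-⟦⟧ (var p) nρ = nρ p
Normal-⟦⟧ ⊤'      nρ = Normal-⊤ᵛ
Normal-⟦⟧ (A ∧ B) nρ = Normal-∧ᵛ (cnf (Normal-⟦⟧ A nρ)) (cnf (Normal-⟦⟧ B nρ))
Normal-⟦⟧ (◇ n A) nρ = Normal-◇ᵛ n (cnf (Normal-⟦⟧ A nρ))
Normal-⟦⟧ (∇ n A) nρ = Normal-∇ᵛ n (Normal-⟦⟧ A nρ)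

⟦subst⟧ : ∀ σ A ρ → ⟦ Defs.subst σ A ⟧ ρ ≡ ⟦ A ⟧ (λ p → ⟦ σ p ⟧ ρ)
⟦subst⟧ σ (var p) ρ = refl
⟦subst⟧ σ ⊤'      ρ = refl
⟦subst⟧ σ (A ∧ B) ρ = cong₂ _∧ᵛ_ (⟦subst⟧ σ A ρ) (⟦subst⟧ σ B ρ)
⟦subst⟧ σ (◇ n A) ρ = cong (◇ᵛ n) (⟦subst⟧ σ A ρ)
⟦subst⟧ σ (∇ n A) ρ = cong (∇ᵛ n) (⟦subst⟧ σ A ρ)

soundness : ∀ {A B} → A ⊢ B → ∀ ρ → NormalValuation ρ → ⟦ A ⟧ ρ ≽ ⟦ B ⟧ ρ
soundness refl⊢                     ρ nρ = ≽-refl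
soundness top                       ρ nρ = pointwise λ _ → 𝟎≤ _
soundness (∧-elˡ {A} {B})           ρ nρ = ∧ᵛ-≽ˡ (⟦ A ⟧ ρ) (⟦ B ⟧ ρ)
soundness (∧-elʳ {A} {B})           ρ nρ = ∧ᵛ-≽ʳ (⟦ A ⟧ ρ) (⟦ B ⟧ ρ)
soundness (cut A⊢B B⊢C)             ρ nρ = ≽-trans (soundness A⊢B ρ nρ) (soundness B⊢C ρ nρ)
soundness (∧-intro {A} A⊢B A⊢C)     ρ nρ =
  ∧ᵛ-greatest (Normal-⟦⟧ A nρ) (soundness A⊢B ρ nρ) (soundness A⊢C ρ nρ)
soundness (mono {A} (dia n) A⊢B)    ρ nρ = ◇ᵛ-mono n (cnf (Normal-⟦⟧ A nρ)) (soundness A⊢B ρ nρ)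
soundness (mono (nab n) A⊢B)        ρ nρ = ∇ᵛ-mono n (soundness A⊢B ρ nρ)
soundness (trans4 {A} (dia n))      ρ nρ = ◇ᵛ-idem n (⟦ A ⟧ ρ)
soundness (trans4 {A} (nab n))      ρ nρ = ∇ᵛ-idem n (⟦ A ⟧ ρ)
soundness (◇-mono {A = A} m<n)      ρ nρ = ◇ᵛ-anti (⟦ A ⟧ ρ) (ℕ.<⇒≤ m<n) (cnf (Normal-⟦⟧ A nρ))
soundness (◇-J {A = A} {B} m<n)     ρ nρ = ◇ᵛ-J m<n (Normal-⟦⟧ A nρ) (cnf (Normal-⟦⟧ B nρ))
soundness (∇-mono {A = A} m<n)      ρ nρ = ∇ᵛ-anti (⟦ A ⟧ ρ) (ℕ.<⇒≤ m<n)
soundness (∇-J {A = A} {B} m<n)     ρ nρ = ∇ᵛ-J m<n (Normal-⟦⟧ A nρ) (cnf (Normal-⟦⟧ B nρ))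
soundness (∇-refl {n} {A})          ρ nρ = ≽-∇ᵛ n (⟦ A ⟧ ρ)
soundness (◇→∇ {n} {A})             ρ nρ = ◇ᵛ≽∇ᵛ n (⟦ A ⟧ ρ)
soundness (◇∇ {A = A} m≤n)          ρ nρ = ◇ᵛ∇ᵛ (⟦ A ⟧ ρ) m≤n (cnf (Normal-⟦⟧ A nρ))
soundness (∇◇ {A = A} m≤n)          ρ nρ = ∇ᵛ◇ᵛ (⟦ A ⟧ ρ) m≤n
soundness (subst⊢ {A} {B} σ A⊢B)    ρ nρ =
  subst₂ _≽_ (sym (⟦subst⟧ σ A ρ)) (sym (⟦subst⟧ σ B ρ))
    (soundness A⊢B (λ p → ⟦ σ p ⟧ ρ) λ p → Normal-⟦⟧ (σ p) nρ)

corollary1 : (A : Formula) (n : ℕ) → ¬ (A ⊢ ◇ n A)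
corollary1 A n A⊢◇A = <⇒≱ (◇ᵛ-strict n x) (at (soundness A⊢◇A ρ λ _ → Normal-⊤ᵛ) n)
  where
  ρ : ℕ → V
  ρ _ = ⊤ᵛ
  x : V
  x = ⟦ A ⟧ ρ
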